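{- Let $s\ge2$ and $A=\{\alpha_1,\dots,\alpha_s\}$. Let $L^\infty=A^\star\alpha_1^\omega\cup\dots\cup A^\star\alpha_s^\omega$ be the (countable) set of infinite words over $A$ that are eventually constant. Let $T^\infty:\mathbb{N}\times\mathbb{N}\to A$ be an infinite tableau whose rows are the elements of $L^\infty$, each listed once. Then: (1) $T^\infty$ is Cantorian, i.e. $\mathrm{Perm}(T^\infty)\cap L^\infty=\emptyset$; (2) if $s=2$, then $T^\infty$ is not bi-Cantorian, i.e. $\mathrm{Perm}(T^\infty)\cap(C^\omega\cup L^\infty)\neq\emptyset$, where $C^\omega$ is the set of column-words of $T^\infty$.
   Context: For an infinite tableau $T=(a_i^j)$ with row index $i\in\mathbb{N}$ and column index $j\in\mathbb{N}$, the permanent is the set of infinite words $\mathrm{Perm}(T)=\{a^1_{\pi(1)}a^2_{\pi(2)}a^3_{\pi(3)}\cdots:\pi:\mathbb{N}\to\mathbb{N}\text{ bijective}\}$. A tableau is Cantorian if its permanent is disjoint from its set of row-words. It is bi-Cantorian if its permanent is disjoint from the union of its set of row-words and its set of column-words. Here $u^\omega$ denotes the infinite repetition of $u$. -}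

module Defs where

open import Data.Nat using (ℕ; _≥_)
open import Data.Fin using (Fin)
open import Data.Product using (Σ; ∃; _×_)
open import Data.Sum using (_⊎_)
open import Relation.Binary.PropositionalEquality using (_≡_)
open import Relation.Nullary using (¬_)
open import Function.Definitions using (Bijective)

-- Infinite words over the alphabet A = Fin s  (α₁,…,αₛ ↦ 0,…,s-1).
Word : ℕ → Set
Word s = ℕ → Fin s

-- Equality of infinite words (pointwise; no function extensionality).
_≈w_ : ∀ {s} → Word s → Word s → Set
u ≈w v = ∀ n → u n ≡ v n

EventuallyConstant : ∀ {s} → Word s → Set
EventuallyConstant {s} w = Σ (Fin s) λ a → Σ ℕ λ N → ∀ n → n ≥ N → w n ≡ a

-- Infinite tableau: T i j = a_i^j (row i, column j).
Tableau : ℕ → Set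
Tableau s = ℕ → ℕ → Fin s

row : ∀ {s} → Tableau s → ℕ → Word s
row T i = λ j → T i j

col : ∀ {s} → Tableau s → ℕ → Word s
col T j = λ i → T i j

permWord : ∀ {s} → Tableau s → (ℕ → ℕ) → Word s
permWord T π = λ j → T (π j) j

InPerm : ∀ {s} → Tableau s → Word s → Set
InPerm T w = Σ (ℕ → ℕ) λ π → Bijective _≡_ _≡_ π × (permWord T π ≈w w)

IsRowWord : ∀ {s} → Tableau s → Word s → Set
IsRowWord T w = ∃ λ i → row T i ≈w w

IsColumnWord : ∀ {s} → Tableau s → Word s → Set
IsColumnWord T w = ∃ λ j → col T j ≈w w

Cantorian : ∀ {s} → Tableau s → Set
Cantorian T = ∀ w → InPerm T w → ¬ IsRowWord T w

BiCantorian : ∀ {s} → Tableau s → Set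
BiCantorian T = ∀ w → InPerm T w → ¬ (IsRowWord T w ⊎ IsColumnWord T w)

PermMeetsRowsOrColumns : ∀ {s} → Tableau s → Set
PermMeetsRowsOrColumns T =
  ∃ λ w → InPerm T w × (IsColumnWord T w ⊎ IsRowWord T w)

RowsEnumerateL∞ : ∀ {s} → Tableau s → Set
RowsEnumerateL∞ {s} T =
  (∀ i → EventuallyConstant (row T i))
  × (∀ i i′ → row T i ≈w row T i′ → i ≡ i′)
  × (∀ (w : Word s) → EventuallyConstant w → ∃ λ i → row T i ≈w w)

-- (1) Suppose a permutation word is constantly a from column N on, and pick b ≠ a.  The N + 1
-- rows aᵗ bᵚ (t ≤ N) are used in N + 1 distinct columns, so one of them is used in a column
-- j ≥ N ≥ t, where it contributes b.  Hence no permutation word lies in L^∞.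
-- (2) For s = 2 every letter occurs infinitely often in the first column c, so the positions j
-- correspond bijectively to pairs (b, k) where c j = b and j is the k-th occurrence of b.  The
-- words b ⊕ bits(k) (binary digits of k, flipped when b = 1) enumerate the eventually-b words
-- without repetition and equal b from position k ≤ j on; using row b ⊕ bits(k) in column j
-- is therefore a permutation whose word is c.

module Submission where

open import Defs
open import Data.Nat
  using (ℕ; zero; suc; _+_; _≤_; _<_; _≤′_; ≤′-refl; ≤′-step; z≤n; s≤s; _<?_; ⌊_/2⌋)
open import Data.Nat.Properties
  using (≤-refl; ≤-reflexive; ≤-trans; ≤-pred; <⇒≢; ≮⇒≥; <-cmp; suc-injective; n≤1+n;
         m≤n⇒m≤1+n; m≤n⇒m<n∨m≡n; ≤⇒≤′; m≤m+n; m≤n+m; +-suc; ⌊n/2⌋<n; n≡⌊n+n/2⌋; n≡⌈n+n/2⌉)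
open import Data.Fin using (Fin; toℕ; fromℕ<)
open import Data.Fin.Patterns using (0F; 1F)
open import Data.Fin.Properties using (toℕ≤pred[n]; toℕ-fromℕ<; pigeonhole; ¬∀⟶∃¬; _≟_)
open import Data.Product using (∃; _×_; _,_; proj₁; proj₂)
open import Data.Sum using (inj₁; inj₂)
open import Data.Empty using (⊥-elim)
open import Relation.Nullary using (¬_; yes; no; contradiction)
open import Relation.Binary using (tri<; tri≈; tri>)
open import Relation.Binary.PropositionalEquality
  using (_≡_; _≢_; refl; sym; trans; cong; cong₂; module ≡-Reasoning)
open import Function.Definitions using (Injective; Surjective; StrictlySurjective)
open import Function.Consequences
  using (surjective⇒strictlySurjective; strictlySurjective⇒surjective)

other : ∀ {n} → Fin (suc (suc n)) → Fin (suc (suc n))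
other 0F = 1F
other (Fin.suc _) = 0F

other-≢ : ∀ {n} (a : Fin (suc (suc n))) → other a ≢ a
other-≢ 0F ()
other-≢ (Fin.suc _) ()

step : ∀ {s} → Fin s → Fin s → ℕ → Word s
step x y t i with i <? t
... | yes _ = x
... | no _ = y

step-< : ∀ {s} (x y : Fin s) {t i} → i < t → step x y t i ≡ x
step-< x y {t} {i} i<t with i <? t
... | yes _ = refl
... | no i≮t = contradiction i<t i≮t

step-≥ : ∀ {s} (x y : Fin s) {t i} → t ≤ i → step x y t i ≡ y
step-≥ x y {t} {i} t≤i with i <? t
... | yes i<t = contradiction refl (<⇒≢ (≤-trans i<t t≤i))
... | no _ = refl

step-eventuallyConstant : ∀ {s} (x y : Fin s) t → EventuallyConstant (step x y t)
step-eventuallyConstant x y t = y , t , λ i t≤i → step-≥ x y t≤i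

step-injective : ∀ {s} {x y : Fin s} → x ≢ y → ∀ {t t′} → step x y t ≈w step x y t′ → t ≡ t′
step-injective {x = x} {y} x≢y {t} {t′} eq with <-cmp t t′
... | tri< t<t′ _ _ =
  ⊥-elim (x≢y (trans (sym (step-< x y t<t′)) (trans (sym (eq t)) (step-≥ x y ≤-refl))))
... | tri≈ _ t≡t′ _ = t≡t′
... | tri> _ _ t′<t =
  ⊥-elim (x≢y (trans (sym (step-< x y t′<t)) (trans (eq t′) (step-≥ x y ≤-refl))))

injective⇒¬bounded : {h : ℕ → ℕ} → Injective _≡_ _≡_ h →
                     ∀ n → ¬ (∀ (t : Fin (suc n)) → h (toℕ t) < n)
injective⇒¬bounded h-injective n below
  with i , j , i<j , same ← pigeonhole ≤-refl (λ t → fromℕ< (below t))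
  = <⇒≢ i<j (h-injective (trans (sym (toℕ-fromℕ< (below i)))
                                (trans (cong toℕ same) (toℕ-fromℕ< (below j)))))

injective⇒∃large-value : {h : ℕ → ℕ} → Injective _≡_ _≡_ h → ∀ n → ∃ λ t → t ≤ n × n ≤ h t
injective⇒∃large-value {h} h-injective n
  with t , h[t]≮n ← ¬∀⟶∃¬ (suc n) (λ t → h (toℕ t) < n) (λ t → h (toℕ t) <? n)
                                  (injective⇒¬bounded h-injective n)
  = toℕ t , toℕ≤pred[n] t , ≮⇒≥ h[t]≮n

module Enumeration {s} {T : Tableau s} (enum : RowsEnumerateL∞ T) where

  rows-eventuallyConstant : ∀ i → EventuallyConstant (row T i)
  rows-eventuallyConstant = proj₁ enum

  rows-distinct : ∀ i i′ → row T i ≈w row T i′ → i ≡ i′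
  rows-distinct = proj₁ (proj₂ enum)

  rowOf : (w : Word s) → EventuallyConstant w → ℕ
  rowOf w ec = proj₁ (proj₂ (proj₂ enum) w ec)

  rowOf-spec : ∀ w ec → row T (rowOf w ec) ≈w w
  rowOf-spec w ec = proj₂ (proj₂ (proj₂ enum) w ec)

  stepRow : Fin s → Fin s → ℕ → ℕ
  stepRow x y t = rowOf (step x y t) (step-eventuallyConstant x y t)

  stepRow-spec : ∀ x y t → row T (stepRow x y t) ≈w step x y t
  stepRow-spec x y t = rowOf-spec (step x y t) (step-eventuallyConstant x y t)

  stepRow-injective : ∀ {x y} → x ≢ y → Injective _≡_ _≡_ (stepRow x y)
  stepRow-injective {x} {y} x≢y {t} {t′} same = step-injective x≢y λ i →
    trans (sym (stepRow-spec x y t i))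
          (trans (cong (λ r → T r i) same) (stepRow-spec x y t′ i))

InfinitelyOften : ∀ {s} → Word s → Fin s → Set
InfinitelyOften w b = ∀ n → ∃ λ m → n ≤ m × w m ≡ b

module _ {s} {T : Tableau (suc (suc s))} (enum : RowsEnumerateL∞ T) where
  open Enumeration enum

  permWord-notEventuallyConstant : ∀ {π} → Surjective _≡_ _≡_ π →
                                   ¬ EventuallyConstant (permWord T π)
  permWord-notEventuallyConstant {π} π-surjective (a , N , tail)
    = let t , t≤N , N≤h[t] = injective⇒∃large-value h-injective N
      in other-≢ a (begin
          other a                               ≡⟨ sym (step-≥ a (other a) (≤-trans t≤N N≤h[t])) ⟩
          step a (other a) t (h t)              ≡⟨ sym (stepRow-spec a (other a) t (h t)) ⟩
          T (stepRow a (other a) t) (h t)       ≡⟨ cong (λ r → T r (h t)) (sym (π∘preimage _)) ⟩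
          T (π (h t)) (h t)                     ≡⟨ tail (h t) N≤h[t] ⟩
          a                                     ∎)
    where
    open ≡-Reasoning
    preimage : ℕ → ℕ
    preimage r = proj₁ (surjective⇒strictlySurjective _≡_ refl π-surjective r)
    π∘preimage : ∀ r → π (preimage r) ≡ r
    π∘preimage r = proj₂ (surjective⇒strictlySurjective _≡_ refl π-surjective r)
    h : ℕ → ℕ
    h t = preimage (stepRow a (other a) t)
    h-injective : Injective _≡_ _≡_ h
    h-injective same = stepRow-injective (λ e → other-≢ a (sym e))
      (trans (sym (π∘preimage _)) (trans (cong π same) (π∘preimage _)))

  cantorian : Cantorian T
  cantorian w (π , (_ , π-surjective) , π≈w) (i , row≈w)
    with a , N , tail ← rows-eventuallyConstant i
    = permWord-notEventuallyConstant π-surjective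
        (a , N , λ j N≤j → trans (π≈w j) (trans (sym (row≈w j)) (tail j N≤j)))

  firstColumn-infinitelyOften : ∀ b → InfinitelyOften (col T 0) b
  firstColumn-infinitelyOften b n
    = let t , _ , n≤h[t] = injective⇒∃large-value h-injective n
      in h t , n≤h[t] ,
         trans (stepRow-spec b (other b) (suc t) 0) (step-< b (other b) {suc t} (s≤s z≤n))
    where
    h : ℕ → ℕ
    h t = stepRow b (other b) (suc t)
    h-injective : Injective _≡_ _≡_ h
    h-injective same = suc-injective (stepRow-injective (λ e → other-≢ b (sym e)) same)

occurrences : ∀ {s} → Word s → Fin s → ℕ → ℕ
occurrences w b zero = zero
occurrences w b (suc j) with w j ≟ b
... | yes _ = suc (occurrences w b j)
... | no _ = occurrences w b j

module _ {s} (w : Word s) (b : Fin s) where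

  occurrences-hit : ∀ {j} → w j ≡ b → occurrences w b (suc j) ≡ suc (occurrences w b j)
  occurrences-hit {j} hit with w j ≟ b
  ... | yes _ = refl
  ... | no miss = contradiction hit miss

  occurrences-≤-suc : ∀ j → occurrences w b j ≤ occurrences w b (suc j)
  occurrences-≤-suc j with w j ≟ b
  ... | yes _ = n≤1+n _
  ... | no _ = ≤-refl

  occurrences-≤ : ∀ j → occurrences w b j ≤ j
  occurrences-≤ zero = z≤n
  occurrences-≤ (suc j) with w j ≟ b
  ... | yes _ = s≤s (occurrences-≤ j)
  ... | no _ = m≤n⇒m≤1+n (occurrences-≤ j)

  occurrences-mono : ∀ {j m} → j ≤ m → occurrences w b j ≤ occurrences w b m
  occurrences-mono j≤m = mono′ (≤⇒≤′ j≤m)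
    where
    mono′ : ∀ {j m} → j ≤′ m → occurrences w b j ≤ occurrences w b m
    mono′ ≤′-refl = ≤-refl
    mono′ (≤′-step j≤′m) = ≤-trans (mono′ j≤′m) (occurrences-≤-suc _)

  occurrences-<-afterHit : ∀ {j m} → w j ≡ b → j < m → occurrences w b j < occurrences w b m
  occurrences-<-afterHit hit j<m =
    ≤-trans (≤-reflexive (sym (occurrences-hit hit))) (occurrences-mono j<m)

  occurrences-injective : ∀ {j j′} → w j ≡ b → w j′ ≡ b →
                          occurrences w b j ≡ occurrences w b j′ → j ≡ j′
  occurrences-injective {j} {j′} hit hit′ same with <-cmp j j′
  ... | tri< j<j′ _ _ = contradiction same (<⇒≢ (occurrences-<-afterHit hit j<j′))
  ... | tri≈ _ j≡j′ _ = j≡j′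
  ... | tri> _ _ j′<j = contradiction (sym same) (<⇒≢ (occurrences-<-afterHit hit′ j′<j))

  occurrences-unbounded : InfinitelyOften w b → ∀ k → ∃ λ J → k ≤ occurrences w b J
  occurrences-unbounded inf zero = zero , z≤n
  occurrences-unbounded inf (suc k) =
    let J , k≤occ = occurrences-unbounded inf k
        m , J≤m , hit = inf J
    in suc m , ≤-trans (s≤s (≤-trans k≤occ (occurrences-mono J≤m)))
                       (≤-reflexive (sym (occurrences-hit hit)))

  -- A discrete intermediate value theorem: the count grows by steps of at most one.
  occurrences-attains : ∀ {k J} → k < occurrences w b J → ∃ λ j → w j ≡ b × occurrences w b j ≡ k
  occurrences-attains {k} {suc J} k<occ with w J ≟ b
  ... | no _ = occurrences-attains {J = J} k<occ
  ... | yes hit with m≤n⇒m<n∨m≡n (≤-pred k<occ)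
  ...   | inj₁ k<occ′ = occurrences-attains {J = J} k<occ′
  ...   | inj₂ k≡occ = J , hit , sym k≡occ

_∷ᵇ_ : Fin 2 → ℕ → ℕ
0F ∷ᵇ m = m + m
1F ∷ᵇ m = suc (m + m)

lowBit : ℕ → Fin 2
lowBit zero = 0F
lowBit (suc zero) = 1F
lowBit (suc (suc n)) = lowBit n

⌊∷ᵇ/2⌋ : ∀ b m → ⌊ b ∷ᵇ m /2⌋ ≡ m
⌊∷ᵇ/2⌋ 0F m = sym (n≡⌊n+n/2⌋ m)
⌊∷ᵇ/2⌋ 1F m = sym (n≡⌈n+n/2⌉ m)

lowBit-∷ᵇ : ∀ b m → lowBit (b ∷ᵇ m) ≡ b
lowBit-∷ᵇ 0F zero = refl
lowBit-∷ᵇ 1F zero = refl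
lowBit-∷ᵇ 0F (suc m) rewrite +-suc m m = lowBit-∷ᵇ 0F m
lowBit-∷ᵇ 1F (suc m) rewrite +-suc m m = lowBit-∷ᵇ 1F m

lowBit-∷ᵇ-⌊/2⌋ : ∀ n → lowBit n ∷ᵇ ⌊ n /2⌋ ≡ n
lowBit-∷ᵇ-⌊/2⌋ zero = refl
lowBit-∷ᵇ-⌊/2⌋ (suc zero) = refl
lowBit-∷ᵇ-⌊/2⌋ (suc (suc n)) with lowBit n | lowBit-∷ᵇ-⌊/2⌋ n
... | 0F | eq = cong suc (trans (+-suc ⌊ n /2⌋ ⌊ n /2⌋) (cong suc eq))
... | 1F | eq = cong suc (trans (cong suc (+-suc ⌊ n /2⌋ ⌊ n /2⌋)) (cong suc eq))

⌊/2⌋-≤-pred : ∀ {k n} → k ≤ suc n → ⌊ k /2⌋ ≤ n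
⌊/2⌋-≤-pred {zero} _ = z≤n
⌊/2⌋-≤-pred {suc k} k≤n = ≤-pred (≤-trans (⌊n/2⌋<n k) k≤n)

-- least significant digit first
bits : ℕ → Word 2
bits k zero = lowBit k
bits k (suc i) = bits ⌊ k /2⌋ i

value : Word 2 → ℕ → ℕ
value w zero = zero
value w (suc n) = w 0 ∷ᵇ value (λ i → w (suc i)) n

bits-vanish : ∀ {k i} → k ≤ i → bits k i ≡ 0F
bits-vanish {i = zero} z≤n = refl
bits-vanish {k} {suc i} k≤i = bits-vanish (⌊/2⌋-≤-pred k≤i)

value-cong : ∀ {u v} n → u ≈w v → value u n ≡ value v n
value-cong zero _ = refl
value-cong (suc n) u≈v = cong₂ _∷ᵇ_ (u≈v 0) (value-cong n (λ i → u≈v (suc i)))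

value-bits : ∀ n {k} → k ≤ n → value (bits k) n ≡ k
value-bits zero z≤n = refl
value-bits (suc n) {k} k≤n =
  trans (cong (lowBit k ∷ᵇ_) (value-bits n (⌊/2⌋-≤-pred k≤n))) (lowBit-∷ᵇ-⌊/2⌋ k)

bits-value : ∀ n {w} → (∀ i → n ≤ i → w i ≡ 0F) → bits (value w n) ≈w w
bits-value zero tail i = trans (bits-vanish {i = i} z≤n) (sym (tail i z≤n))
bits-value (suc n) {w} tail zero = lowBit-∷ᵇ (w 0) _
bits-value (suc n) {w} tail (suc i) =
  trans (cong (λ m → bits m i) (⌊∷ᵇ/2⌋ (w 0) _))
        (bits-value n (λ i n≤i → tail (suc i) (s≤s n≤i)) i)

bits-injective : ∀ {k k′} → bits k ≈w bits k′ → k ≡ k′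
bits-injective {k} {k′} same = begin
  k                       ≡⟨ sym (value-bits (k + k′) (m≤m+n k k′)) ⟩
  value (bits k) (k + k′)  ≡⟨ value-cong (k + k′) same ⟩
  value (bits k′) (k + k′) ≡⟨ value-bits (k + k′) (m≤n+m k′ k) ⟩
  k′                      ∎
  where open ≡-Reasoning

_⊕_ : Fin 2 → Fin 2 → Fin 2
0F ⊕ x = x
1F ⊕ 0F = 1F
1F ⊕ 1F = 0F

⊕-identityʳ : ∀ b → b ⊕ 0F ≡ b
⊕-identityʳ 0F = refl
⊕-identityʳ 1F = refl

⊕-self : ∀ b → b ⊕ b ≡ 0F
⊕-self 0F = refl
⊕-self 1F = refl

⊕-involutive : ∀ b x → b ⊕ (b ⊕ x) ≡ x
⊕-involutive 0F x = refl
⊕-involutive 1F 0F = refl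
⊕-involutive 1F 1F = refl

encode : Fin 2 → ℕ → Word 2
encode b k i = b ⊕ bits k i

encode-tail : ∀ b {k i} → k ≤ i → encode b k i ≡ b
encode-tail b k≤i = trans (cong (b ⊕_) (bits-vanish k≤i)) (⊕-identityʳ b)

encode-eventuallyConstant : ∀ b k → EventuallyConstant (encode b k)
encode-eventuallyConstant b k = b , k , λ i k≤i → encode-tail b k≤i

encode-injective : ∀ {b b′ k k′} → encode b k ≈w encode b′ k′ → b ≡ b′ × k ≡ k′
encode-injective {b} {b′} {k} {k′} same = b≡b′ , bits-injective bits≈
  where
  b≡b′ : b ≡ b′
  b≡b′ = trans (sym (encode-tail b (m≤m+n k k′)))
               (trans (same (k + k′)) (encode-tail b′ (m≤n+m k′ k)))
  bits≈ : bits k ≈w bits k′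
  bits≈ i = trans (sym (⊕-involutive b (bits k i)))
                  (trans (cong₂ _⊕_ b≡b′ (same i)) (⊕-involutive b′ (bits k′ i)))

encode-surjective : ∀ {b N w} → (∀ i → N ≤ i → w i ≡ b) → ∃ λ k → encode b k ≈w w
encode-surjective {b} {N} {w} tail = value b⊕w N , λ i →
  trans (cong (b ⊕_) (bits-value N b⊕w-tail i)) (⊕-involutive b (w i))
  where
  b⊕w : Word 2
  b⊕w i = b ⊕ w i
  b⊕w-tail : ∀ i → N ≤ i → b⊕w i ≡ 0F
  b⊕w-tail i N≤i = trans (cong (b ⊕_) (tail i N≤i)) (⊕-self b)

module _ {T : Tableau 2} (enum : RowsEnumerateL∞ T) where
  open Enumeration enum

  private
    c : Word 2
    c = col T 0

    rank : ℕ → ℕ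
    rank j = occurrences c (c j) j

  diagonalRow : ℕ → ℕ
  diagonalRow j = rowOf (encode (c j) (rank j)) (encode-eventuallyConstant (c j) (rank j))

  diagonalRow-spec : ∀ j → row T (diagonalRow j) ≈w encode (c j) (rank j)
  diagonalRow-spec j = rowOf-spec (encode (c j) (rank j)) (encode-eventuallyConstant (c j) (rank j))

  permWord-diagonalRow : permWord T diagonalRow ≈w col T 0
  permWord-diagonalRow j =
    trans (diagonalRow-spec j j) (encode-tail (c j) (occurrences-≤ c (c j) j))

  diagonalRow-injective : Injective _≡_ _≡_ diagonalRow
  diagonalRow-injective {j} {j′} same =
    let c≡c′ , rank≡rank′ = encode-injective λ i →
          trans (sym (diagonalRow-spec j i))
                (trans (cong (λ r → T r i) same) (diagonalRow-spec j′ i))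
    in occurrences-injective c (c j) refl (sym c≡c′)
        (trans rank≡rank′ (cong (λ b → occurrences c b j′) (sym c≡c′)))

  diagonalRow-reaches : ∀ a k → ∃ λ j → row T (diagonalRow j) ≈w encode a k
  diagonalRow-reaches a k =
    let J , k<occ = occurrences-unbounded c a (firstColumn-infinitelyOften enum a) (suc k)
        j , c[j]≡a , rank≡k = occurrences-attains c a {J = J} k<occ
    in j , λ n → trans (diagonalRow-spec j n) (cong₂ (λ b m → encode b m n) c[j]≡a
                          (trans (cong (λ b → occurrences c b j) c[j]≡a) rank≡k))

  diagonalRow-surjective : Surjective _≡_ _≡_ diagonalRow
  diagonalRow-surjective = strictlySurjective⇒surjective trans (cong diagonalRow) strictly
    where
    strictly : StrictlySurjective _≡_ diagonalRow
    strictly i =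
      let a , N , tail = rows-eventuallyConstant i
          k , encode≈row = encode-surjective tail
          j , row≈encode = diagonalRow-reaches a k
      in j , rows-distinct (diagonalRow j) i λ n → trans (row≈encode n) (encode≈row n)

  firstColumn-inPerm : InPerm T (col T 0)
  firstColumn-inPerm =
    diagonalRow , (diagonalRow-injective , diagonalRow-surjective) , permWord-diagonalRow

theorem6p1 : (s : ℕ) → 2 ≤ s → (T : Tableau s) → RowsEnumerateL∞ T →
    Cantorian T × (s ≡ 2 → PermMeetsRowsOrColumns T)
theorem6p1 (suc (suc _)) (s≤s (s≤s z≤n)) T enum =
  cantorian enum , λ { refl → col T 0 , firstColumn-inPerm enum , inj₁ (0 , λ _ → refl) }
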